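{- Let $k\geq 1$ and $d\geq 1$ be integers. There is a constant $c$ depending only on $k$ and $d$ such that the following holds: for every tree $T$ whose maximum vertex degree is at most $d$, and every $k$-tree $G$ that contains $T$ as a spanning subgraph, every $(k+1)$-clique of $G$ has at most $c$ neighbors. In other words, the class of bounded-degree trees consists of bounded branching friendly graphs.
   Context: $k$-trees are defined recursively: a $k$-tree with exactly $k$ vertices is a $k$-clique; for $n>k$, a $k$-tree with $n$ vertices is obtained from a $k$-tree with $n-1$ vertices by adding a new vertex adjacent to exactly the vertices of some existing $k$-clique. For a $(k+1)$-clique $\Delta$ of a $k$-tree $G$, a neighbor of $\Delta$ is a $(k+1)$-clique $\Delta'$ of $G$ with $|\Delta\cap\Delta'|=k$. A $k$-tree has bounded branches if every $(k+1)$-clique in it has a bounded number of neighbors; a graph $H$ is bounded branching friendly if every $k$-tree containing $H$ as a spanning subgraph has bounded branches (for a class of graphs, the bound is uniform over the class, depending only on the class and $k$). -}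

module Defs where

open import Data.Nat using (ℕ; zero; suc; _≤_)
open import Data.Bool using (Bool; true; false; not)
open import Data.Fin using (Fin; zero; suc; _≟_)
open import Data.Fin.Subset using (Subset; _∈_; _∩_; ∣_∣)
open import Data.Vec using (tabulate; lookup)
open import Data.Unit using (⊤)
open import Data.Empty using (⊥)
open import Data.Maybe using (just)
open import Data.List using (List; []; _∷_; last; foldl)
open import Data.List.Relation.Unary.Unique.Propositional using (Unique)
open import Data.Product using (Σ; ∃; ∃-syntax; _×_; _,_)
open import Function.Bundles using (_↔_; Inverse)
open import Relation.Binary.PropositionalEquality using (_≡_; _≢_)
open import Relation.Nullary using (¬_)
open import Relation.Nullary.Decidable using (⌊_⌋)

Graph : ℕ → Set
Graph n = Fin n → Fin n → Bool

IsSimple : ∀ {n} → Graph n → Set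
IsSimple {n} E = (∀ (i j : Fin n) → E i j ≡ E j i) × (∀ (i : Fin n) → E i i ≡ false)

IsClique : ∀ {n} → Graph n → ℕ → Subset n → Set
IsClique {n} E m S =
  ∣ S ∣ ≡ m × (∀ (i j : Fin n) → i ∈ S → j ∈ S → i ≢ j → E i j ≡ true)

complete : ∀ k → Graph k
complete k i j = not ⌊ i ≟ j ⌋

extend : ∀ {n} → Graph n → Subset n → Graph (suc n)
extend E S zero    zero    = false
extend E S zero    (suc j) = lookup S j
extend E S (suc i) zero    = lookup S i
extend E S (suc i) (suc j) = E i j

-- Graphs built literally by the recursive definition of a k-tree.
data BuiltKTree (k : ℕ) : (n : ℕ) → Graph n → Set where
  base : BuiltKTree k k (complete k)
  step : ∀ {n E} → BuiltKTree k n E → (S : Subset n) → IsClique E k S →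
         BuiltKTree k (suc n) (extend E S)

-- G is a k-tree: isomorphic (by a relabelling of vertices) to a built k-tree.
IsKTree : ∀ (k : ℕ) {n} → Graph n → Set
IsKTree k {n} G = Σ (Graph n) λ E → BuiltKTree k n E ×
  Σ (Fin n ↔ Fin n) λ σ → ∀ (i j : Fin n) → G i j ≡ E (Inverse.to σ i) (Inverse.to σ j)

Consecutive : ∀ {n} → Graph n → List (Fin n) → Set
Consecutive E []            = ⊤
Consecutive E (x ∷ [])      = ⊤
Consecutive E (x ∷ y ∷ xs)  = E x y ≡ true × Consecutive E (y ∷ xs)

PathFromTo : ∀ {n} → Graph n → Fin n → Fin n → List (Fin n) → Set
PathFromTo E u v []       = ⊥
PathFromTo E u v (x ∷ xs) = x ≡ u × last (x ∷ xs) ≡ just v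
                            × Unique (x ∷ xs) × Consecutive E (x ∷ xs)

Connected : ∀ {n} → Graph n → Set
Connected {n} E = ∀ (u v : Fin n) → ∃[ p ] PathFromTo E u v p

-- A cycle: distinct vertices x ∷ y ∷ z ∷ rest, consecutively adjacent,
-- with the last vertex adjacent to the first.
IsCycle : ∀ {n} → Graph n → List (Fin n) → Set
IsCycle E (x ∷ y ∷ z ∷ rest) = Unique (x ∷ y ∷ z ∷ rest) × Consecutive E (x ∷ y ∷ z ∷ rest)
  × E (foldl (λ _ w → w) z rest) x ≡ true
IsCycle E _ = ⊥

Acyclic : ∀ {n} → Graph n → Set
Acyclic E = ∀ c → ¬ IsCycle E c

IsTree : ∀ {n} → Graph n → Set
IsTree E = IsSimple E × Connected E × Acyclic E

degree : ∀ {n} → Graph n → Fin n → ℕ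
degree E v = ∣ tabulate (λ j → E v j) ∣

MaxDegreeAtMost : ∀ {n} → Graph n → ℕ → Set
MaxDegreeAtMost {n} E d = ∀ (v : Fin n) → degree E v ≤ d

SpanningSubgraph : ∀ {n} → Graph n → Graph n → Set
SpanningSubgraph {n} T G = ∀ (i j : Fin n) → T i j ≡ true → G i j ≡ true

IsNeighbor : ∀ (k : ℕ) {n} → Graph n → Subset n → Subset n → Set
IsNeighbor k G Δ Δ' = IsClique G (suc k) Δ' × ∣ Δ ∩ Δ' ∣ ≡ k

{-# OPTIONS --safe #-}
-- Write a neighbour Δ' of the (k+1)-clique Δ as Δ - u + v.  In a k-tree every k-clique K
-- separates any two distinct vertices adjacent to all of K (induction along the construction),
-- so v is the only vertex adjacent to all of Δ - u in its component of G - (Δ - u).  Follow a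
-- walk in T from v until it first enters Δ - u, and let w be its last vertex before that:
-- w is a T-neighbour of Δ lying in the component of v, so the pair (u , w) determines v and
-- hence Δ'.  There are at most (k+1) · (k+1)d such pairs.
module Submission where

open import Defs
open import Data.Bool using (Bool; true)
open import Data.Empty using (⊥-elim)
open import Data.Fin using (Fin; zero; suc; _≟_)
open import Data.Fin.Properties using (suc-injective; any?; injective⇒≤)
open import Data.Fin.Subset
  using (Subset; inside; outside; _∈_; _∉_; _⊆_; _⊂_; _∩_; _∪_; _-_; ⁅_⁆; ⊥; ∣_∣; Nonempty)
open import Data.Fin.Subset.Properties
  using ( _∈?_; ∈⊤; ∣p∣≤n; ∣⊥∣≡0; ∣p∣≡n⇒p≡⊤; p⊆q⇒∣p∣≤∣q∣; p⊂q⇒∣p∣<∣q∣; ⊆-antisym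
        ; x∈⁅x⁆; x∈⁅y⁆⇒x≡y; p⊆p∪q; x∈p∪q⁺; x∈p∪q⁻; x∈p∩q⁺; x∈p∩q⁻; p∩q⊆p; p∩q⊆q
        ; p─q⊆p; x∈p∧x≢y⇒x∈p-y)
open import Data.List using (List; []; _∷_; length; map; concatMap; cartesianProduct; last; lookup)
open import Data.List.Properties using (length-map; length-++)
open import Data.List.Membership.Propositional using (lose) renaming (_∈_ to _∈ˡ_)
open import Data.List.Membership.Propositional.Properties
  using (∈-map⁺; ∈-map⁻; ∈-lookup; ∈-concatMap⁺; ∈-cartesianProduct⁺)
open import Data.List.Membership.Setoid.Properties using (index-injective)
open import Data.List.Relation.Unary.All as All using (All)
open import Data.List.Relation.Unary.All.Properties using () renaming (map⁺ to All-map⁺)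
open import Data.List.Relation.Unary.Any using (here; there)
open import Data.List.Relation.Unary.Unique.Propositional using (Unique; []; _∷_)
open import Data.List.Relation.Unary.Unique.Propositional.Properties
  using () renaming (map⁺ to Unique-map⁺)
open import Data.Maybe using (just)
open import Data.Nat using (ℕ; suc; _≤_; _<_; _+_; _*_; s≤s; z≤n)
open import Data.Nat.Properties
  using (≤-trans; ≤-reflexive; ≤-antisym; ≤⇒≯; <⇒≱; +-mono-≤; *-monoʳ-≤; module ≤-Reasoning)
open import Data.Product using (∃; ∃₂; ∃-syntax; _×_; _,_; proj₁; proj₂)
open import Data.Sum using (inj₂; [_,_])
open import Data.Vec using ([]; _∷_; here; there; tabulate) renaming (lookup to vlookup)
open import Data.Vec.Properties using (lookup∘tabulate; lookup⇒[]=; []=⇒lookup)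
open import Function using (_∘_; id; _↔_; Inverse)
open import Relation.Binary using (Rel; Sym)
open import Relation.Binary.Construct.Closure.ReflexiveTransitive
  using (Star; ε; _◅_; _◅◅_; gmap; reverse)
open import Relation.Binary.PropositionalEquality
  using (_≡_; _≢_; refl; sym; trans; cong; cong₂; subst; subst₂; setoid)
open import Relation.Nullary using (¬_; yes; no; ¬?)
open import Relation.Nullary.Decidable using (decidable-stable; _×-dec_)

private
  variable
    A B : Set
    m n : ℕ

-- Finite sets and counting

lookup-injective : {xs : List A} → Unique xs → ∀ {i j} → lookup xs i ≡ lookup xs j → i ≡ j
lookup-injective (_ ∷ _)         {zero}  {zero}  _  = refl
lookup-injective (x∉xs ∷ _)      {zero}  {suc j} eq = ⊥-elim (All.lookup x∉xs (∈-lookup j) eq)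
lookup-injective (x∉xs ∷ _)      {suc i} {zero}  eq = ⊥-elim (All.lookup x∉xs (∈-lookup i) (sym eq))
lookup-injective (_ ∷ xs-unique) {suc i} {suc j} eq = cong suc (lookup-injective xs-unique eq)

injection⇒length≤ : {xs : List A} {ys : List B} → Unique xs → (f : ∀ {x} → x ∈ˡ xs → B) →
  (∀ {x y} (p : x ∈ˡ xs) (q : y ∈ˡ xs) → f p ≡ f q → x ≡ y) →
  (∀ {x} (p : x ∈ˡ xs) → f p ∈ˡ ys) → length xs ≤ length ys
injection⇒length≤ xs-unique f f-injective f∈ys = injective⇒≤ λ eq → lookup-injective xs-unique
  (f-injective _ _ (index-injective (setoid _) (f∈ys (∈-lookup _)) (f∈ys (∈-lookup _)) eq))

length-cartesianProduct : (xs : List A) (ys : List B) →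
  length (cartesianProduct xs ys) ≡ length xs * length ys
length-cartesianProduct []       ys = refl
length-cartesianProduct (x ∷ xs) ys = trans (length-++ (map (x ,_) ys))
  (cong₂ _+_ (length-map (x ,_) ys) (length-cartesianProduct xs ys))

length-concatMap≤ : (f : A → List B) {b : ℕ} → (∀ x → length (f x) ≤ b) →
  ∀ xs → length (concatMap f xs) ≤ length xs * b
length-concatMap≤ f f≤b []       = z≤n
length-concatMap≤ f f≤b (x ∷ xs) =
  ≤-trans (≤-reflexive (length-++ (f x))) (+-mono-≤ (f≤b x) (length-concatMap≤ f f≤b xs))

elements : Subset n → List (Fin n)
elements []            = []
elements (inside ∷ p)  = zero ∷ map suc (elements p)
elements (outside ∷ p) = map suc (elements p)

length-elements : (p : Subset n) → length (elements p) ≡ ∣ p ∣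
length-elements []            = refl
length-elements (inside ∷ p)  = cong suc (trans (length-map suc (elements p)) (length-elements p))
length-elements (outside ∷ p) = trans (length-map suc (elements p)) (length-elements p)

elements-unique : (p : Subset n) → Unique (elements p)
elements-unique []            = []
elements-unique (inside ∷ p)  =
  All-map⁺ (All.universal (λ _ ()) (elements p)) ∷ Unique-map⁺ suc-injective (elements-unique p)
elements-unique (outside ∷ p) = Unique-map⁺ suc-injective (elements-unique p)

∈-elements⁺ : {p : Subset n} {x : Fin n} → x ∈ p → x ∈ˡ elements p
∈-elements⁺ {p = inside ∷ p}  here         = here refl
∈-elements⁺ {p = inside ∷ p}  (there x∈p) = there (∈-map⁺ suc (∈-elements⁺ x∈p))
∈-elements⁺ {p = outside ∷ p} (there x∈p) = ∈-map⁺ suc (∈-elements⁺ x∈p)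

∈-elements⁻ : (p : Subset n) {x : Fin n} → x ∈ˡ elements p → x ∈ p
∈-elements⁻ (inside ∷ p)  (here refl) = here
∈-elements⁻ (inside ∷ p)  (there x∈)  with ∈-map⁻ suc x∈
... | _ , y∈ , refl = there (∈-elements⁻ p y∈)
∈-elements⁻ (outside ∷ p) x∈          with ∈-map⁻ suc x∈
... | _ , y∈ , refl = there (∈-elements⁻ p y∈)

∣p∣≤∣q∣-of-injection : {p : Subset m} {q : Subset n} (f : Fin m → Fin n) →
  (∀ {x y} → f x ≡ f y → x ≡ y) → (∀ {x} → x ∈ p → f x ∈ q) → ∣ p ∣ ≤ ∣ q ∣
∣p∣≤∣q∣-of-injection {p = p} {q} f f-injective f[p]⊆q = begin
  ∣ p ∣               ≡⟨ length-elements p ⟨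
  length (elements p) ≤⟨ injection⇒length≤ (elements-unique p) (λ {x} _ → f x) (λ _ _ → f-injective)
                           (∈-elements⁺ ∘ f[p]⊆q ∘ ∈-elements⁻ p) ⟩
  length (elements q) ≡⟨ length-elements q ⟩
  ∣ q ∣               ∎
  where open ≤-Reasoning

∣p∣<∣q∣⇒∃∈q∉p : {p q : Subset n} → ∣ p ∣ < ∣ q ∣ → ∃ λ x → x ∈ q × x ∉ p
∣p∣<∣q∣⇒∃∈q∉p {p = p} {q} ∣p∣<∣q∣ with any? (λ x → x ∈? q ×-dec ¬? (x ∈? p))
... | yes found = found
... | no none   = ⊥-elim (<⇒≱ ∣p∣<∣q∣ (p⊆q⇒∣p∣≤∣q∣ q⊆p))
  where
  q⊆p : q ⊆ p
  q⊆p {x} x∈q = decidable-stable (x ∈? p) (λ x∉p → none (x , x∈q , x∉p))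

1≤∣p∣⇒nonempty : {p : Subset n} → 1 ≤ ∣ p ∣ → Nonempty p
1≤∣p∣⇒nonempty {n} {p} 1≤∣p∣ =
  let x , x∈p , _ = ∣p∣<∣q∣⇒∃∈q∉p {p = ⊥} (subst (_< ∣ p ∣) (sym (∣⊥∣≡0 n)) 1≤∣p∣) in x , x∈p

∈q∉p-unique : {p q : Subset n} {x y : Fin n} → p ⊆ q → ∣ q ∣ ≤ suc ∣ p ∣ →
  x ∈ q → x ∉ p → y ∈ q → y ∉ p → x ≡ y
∈q∉p-unique {p = p} {q} {x} {y} p⊆q ∣q∣≤1+∣p∣ x∈q x∉p y∈q y∉p with x ≟ y
... | yes x≡y = x≡y
... | no x≢y  = ⊥-elim (≤⇒≯ ∣q∣≤1+∣p∣ (≤-trans (s≤s (p⊂q⇒∣p∣<∣q∣ p⊂p+x)) (p⊂q⇒∣p∣<∣q∣ p+x⊂q)))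
  where
  p⊂p+x : p ⊂ p ∪ ⁅ x ⁆
  p⊂p+x = p⊆p∪q ⁅ x ⁆ , x , x∈p∪q⁺ (inj₂ (x∈⁅x⁆ x)) , x∉p
  p+x⊆q : p ∪ ⁅ x ⁆ ⊆ q
  p+x⊆q z∈ = [ p⊆q , (λ z∈⁅x⁆ → subst (_∈ q) (sym (x∈⁅y⁆⇒x≡y x z∈⁅x⁆)) x∈q) ] (x∈p∪q⁻ p ⁅ x ⁆ z∈)
  y∉p+x : y ∉ p ∪ ⁅ x ⁆
  y∉p+x y∈ = [ y∉p , (λ y∈⁅x⁆ → x≢y (sym (x∈⁅y⁆⇒x≡y x y∈⁅x⁆))) ] (x∈p∪q⁻ p ⁅ x ⁆ y∈)
  p+x⊂q : p ∪ ⁅ x ⁆ ⊂ q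
  p+x⊂q = p+x⊆q , y , y∈q , y∉p+x

x∈p-y⇒x≢y : {p : Subset n} {x y : Fin n} → x ∈ p - y → x ≢ y
x∈p-y⇒x≢y {p = inside ∷ p}  {zero}  {zero}  ()
x∈p-y⇒x≢y {p = outside ∷ p} {zero}  {zero}  ()
x∈p-y⇒x≢y {p = s ∷ p}       {zero}  {suc y} _          ()
x∈p-y⇒x≢y {p = s ∷ p}       {suc x} {zero}  _          ()
x∈p-y⇒x≢y {p = s ∷ p}       {suc x} {suc y} (there x∈) x≡y = x∈p-y⇒x≢y x∈ (suc-injective x≡y)

∈-tabulate⁺ : {f : Fin n → Bool} {x : Fin n} → f x ≡ inside → x ∈ tabulate f
∈-tabulate⁺ {f = f} {x} fx≡inside = lookup⇒[]= x (tabulate f) (trans (lookup∘tabulate f x) fx≡inside)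

∈-tabulate⁻ : {f : Fin n → Bool} {x : Fin n} → x ∈ tabulate f → f x ≡ inside
∈-tabulate⁻ {f = f} {x} x∈ = trans (sym (lookup∘tabulate f x)) ([]=⇒lookup x∈)

preimage : (Fin m → Fin n) → Subset n → Subset m
preimage f p = tabulate (vlookup p ∘ f)

∈-preimage⁺ : {f : Fin m → Fin n} {p : Subset n} {x : Fin m} → f x ∈ p → x ∈ preimage f p
∈-preimage⁺ fx∈p = ∈-tabulate⁺ ([]=⇒lookup fx∈p)

∈-preimage⁻ : {f : Fin m → Fin n} {p : Subset n} {x : Fin m} → x ∈ preimage f p → f x ∈ p
∈-preimage⁻ {f = f} {p} {x} x∈ = lookup⇒[]= (f x) p (∈-tabulate⁻ x∈)

-- Walks avoiding a set of vertices

Undirected : Graph n → Set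
Undirected {n} G = ∀ (i j : Fin n) → G i j ≡ G j i

neighbourhood : Graph n → Fin n → Subset n
neighbourhood H a = tabulate (H a)

EdgeOutside : Graph n → Subset n → Rel (Fin n) _
EdgeOutside G K x y = x ∉ K × G x y ≡ true × y ∉ K

WalkOutside : Graph n → Subset n → Rel (Fin n) _
WalkOutside G K = Star (EdgeOutside G K)

WalkOutside-reverse : {G : Graph n} {K : Subset n} → Undirected G →
  Sym (WalkOutside G K) (WalkOutside G K)
WalkOutside-reverse G-undirected =
  reverse λ (x∉K , Gxy , y∉K) → y∉K , trans (G-undirected _ _) Gxy , x∉K

WalkOutside-mono : {H G : Graph n} {K : Subset n} → SpanningSubgraph H G →
  ∀ {x y} → WalkOutside H K x y → WalkOutside G K x y
WalkOutside-mono H⊆G = gmap id λ (x∉K , Hxy , y∉K) → x∉K , H⊆G _ _ Hxy , y∉K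

exit-edge : {H : Graph n} {K : Subset n} {x t : Fin n} (xs : List (Fin n)) →
  x ∉ K → t ∈ K → Consecutive H (x ∷ xs) → last (x ∷ xs) ≡ just t →
  ∃₂ λ w a → WalkOutside H K x w × H w a ≡ true × a ∈ K
exit-edge []       x∉K t∈K _ refl = ⊥-elim (x∉K t∈K)
exit-edge {K = K} {x = x} (y ∷ ys) x∉K t∈K (Hxy , Hys) last≡t with y ∈? K
... | yes y∈K = x , y , ε , Hxy , y∈K
... | no  y∉K =
  let w , a , y⇝w , Hwa , a∈K = exit-edge ys y∉K t∈K Hys last≡t
  in  w , a , (x∉K , Hxy , y∉K) ◅ y⇝w , Hwa , a∈K

-- k-cliques separate k-trees

Clique : Graph n → Subset n → Set
Clique {n} G K = ∀ (i j : Fin n) → i ∈ K → j ∈ K → i ≢ j → G i j ≡ true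

AdjacentToAll : Graph n → Subset n → Fin n → Set
AdjacentToAll G K v = ∀ i → i ∈ K → G v i ≡ true

KCliquesSeparate : ℕ → Graph n → Set
KCliquesSeparate k G = ∀ K → k ≤ ∣ K ∣ → Clique G K → ∀ {v v'} → v ∉ K → v' ∉ K →
  AdjacentToAll G K v → AdjacentToAll G K v' → WalkOutside G K v v' → v ≡ v'

complete-undirected : ∀ k → Undirected (complete k)
complete-undirected k i j with i ≟ j | j ≟ i
... | yes _   | yes _   = refl
... | no _    | no _    = refl
... | yes i≡j | no j≢i  = ⊥-elim (j≢i (sym i≡j))
... | no i≢j  | yes j≡i = ⊥-elim (i≢j (sym j≡i))

built-undirected : ∀ {k n E} → BuiltKTree k n E → Undirected E
built-undirected base                         = complete-undirected _
built-undirected (step _ _ _) zero    zero    = refl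
built-undirected (step _ _ _) zero    (suc j) = refl
built-undirected (step _ _ _) (suc i) zero    = refl
built-undirected (step b _ _) (suc i) (suc j) = built-undirected b i j

module _ {k} {E : Graph n} {S : Subset n} (S-clique : IsClique E k S) {K : Subset n} where

  no-walk-from-new-vertex : k ≤ ∣ K ∣ → AdjacentToAll (extend E S) (outside ∷ K) zero →
    ∀ {b} → ¬ WalkOutside (extend E S) (outside ∷ K) zero (suc b)
  no-walk-from-new-vertex k≤∣K∣ 0~K (_◅_ {j = suc c} (_ , c∈S , c∉K) _) =
    ≤⇒≯ (≤-trans (≤-reflexive (proj₁ S-clique)) k≤∣K∣)
      (p⊂q⇒∣p∣<∣q∣ (K⊆S , c , lookup⇒[]= c S c∈S , c∉K ∘ there))
    where
    K⊆S : K ⊆ S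
    K⊆S {i} i∈K = lookup⇒[]= i S (0~K (suc i) (there i∈K))

  -- A detour through the new vertex leaves and re-enters the old graph inside the clique S.
  project : ∀ {a b} → WalkOutside (extend E S) (outside ∷ K) (suc a) (suc b) → WalkOutside E K a b
  project ε = ε
  project (_◅_ {j = suc c} (a∉K , Eac , c∉K) c⇝b) = (a∉K ∘ there , Eac , c∉K ∘ there) ◅ project c⇝b
  project {a} (_◅_ {j = zero} (a∉K , a∈S , _) (_◅_ {j = suc c} (_ , c∈S , c∉K) c⇝b)) with a ≟ c
  ... | yes refl = project c⇝b
  ... | no a≢c   = (a∉K ∘ there , Eac , c∉K ∘ there) ◅ project c⇝b
    where Eac = proj₂ S-clique a c (lookup⇒[]= a S a∈S) (lookup⇒[]= c S c∈S) a≢c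

built-separates : ∀ {k n E} → BuiltKTree k n E → KCliquesSeparate k E
built-separates base K k≤∣K∣ _ {v} v∉K _ _ _ _ =
  ⊥-elim (v∉K (subst (v ∈_) (sym (∣p∣≡n⇒p≡⊤ (≤-antisym (∣p∣≤n K) k≤∣K∣))) ∈⊤))
built-separates (step _ _ _) (inside ∷ K) _ _ {zero}          v∉K _    _ _ _ = ⊥-elim (v∉K here)
built-separates (step _ _ _) (inside ∷ K) _ _ {suc _} {zero}  _   v'∉K _ _ _ = ⊥-elim (v'∉K here)
built-separates (step _ S (∣S∣≡k , _)) (inside ∷ K) k≤∣K∣ K-clique {suc a} {suc a'} a∉K a'∉K a~K a'~K _ =
  cong suc (∈q∉p-unique K⊆S (≤-trans (≤-reflexive ∣S∣≡k) k≤∣K∣)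
    (lookup⇒[]= a S (a~K zero here)) (a∉K ∘ there) (lookup⇒[]= a' S (a'~K zero here)) (a'∉K ∘ there))
  where
  K⊆S : K ⊆ S
  K⊆S {i} i∈K = lookup⇒[]= i S (K-clique zero (suc i) here (there i∈K) λ ())
built-separates (step _ _ _) (outside ∷ K) _ _ {zero} {zero} _ _ _ _ _ = refl
built-separates (step _ _ S-clique) (outside ∷ K) k≤∣K∣ _ {zero} {suc _} _ _ 0~K _ 0⇝v' =
  ⊥-elim (no-walk-from-new-vertex S-clique k≤∣K∣ 0~K 0⇝v')
built-separates b@(step _ _ S-clique) (outside ∷ K) k≤∣K∣ _ {suc _} {zero} _ _ _ 0~K v⇝0 =
  ⊥-elim (no-walk-from-new-vertex S-clique k≤∣K∣ 0~K (WalkOutside-reverse (built-undirected b) v⇝0))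
built-separates (step b _ S-clique) (outside ∷ K) k≤∣K∣ K-clique {suc a} {suc a'} a∉K a'∉K a~K a'~K a⇝a' =
  cong suc (built-separates b K k≤∣K∣ K-clique-old (a∉K ∘ there) (a'∉K ∘ there)
    (λ i i∈K → a~K (suc i) (there i∈K)) (λ i i∈K → a'~K (suc i) (there i∈K)) (project S-clique a⇝a'))
  where
  K-clique-old : Clique _ K
  K-clique-old i j i∈K j∈K i≢j = K-clique (suc i) (suc j) (there i∈K) (there j∈K) (i≢j ∘ suc-injective)

relabel-separates : ∀ {k} {G E : Graph n} (σ : Fin n ↔ Fin n) →
  (∀ i j → G i j ≡ E (Inverse.to σ i) (Inverse.to σ j)) → KCliquesSeparate k E → KCliquesSeparate k G
relabel-separates {G = G} {E} σ G≡E E-separates K k≤∣K∣ K-clique v∉K v'∉K v~K v'~K v⇝v' =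
  to-injective (E-separates K' (≤-trans k≤∣K∣ ∣K∣≤∣K'∣) K'-clique (∉K' v∉K) (∉K' v'∉K) (~K' v~K) (~K' v'~K)
    (gmap to (λ (x∉K , Gxy , y∉K) → ∉K' x∉K , trans (sym (G≡E _ _)) Gxy , ∉K' y∉K) v⇝v'))
  where
  open Inverse σ
  to-injective : ∀ {x y} → to x ≡ to y → x ≡ y
  to-injective {x} {y} eq = trans (sym (strictlyInverseʳ x)) (trans (cong from eq) (strictlyInverseʳ y))
  from-injective : ∀ {x y} → from x ≡ from y → x ≡ y
  from-injective {x} {y} eq = trans (sym (strictlyInverseˡ x)) (trans (cong to eq) (strictlyInverseˡ y))
  K' = preimage from K
  ∉K' : ∀ {x} → x ∉ K → to x ∉ K'
  ∉K' {x} x∉K tox∈K' = x∉K (subst (_∈ K) (strictlyInverseʳ x) (∈-preimage⁻ tox∈K'))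
  ∣K∣≤∣K'∣ : ∣ K ∣ ≤ ∣ K' ∣
  ∣K∣≤∣K'∣ = ∣p∣≤∣q∣-of-injection to to-injective λ {x} x∈K →
    ∈-preimage⁺ (subst (_∈ K) (sym (strictlyInverseʳ x)) x∈K)
  K'-clique : Clique E K'
  K'-clique i j i∈K' j∈K' i≢j =
    subst₂ (λ x y → E x y ≡ true) (strictlyInverseˡ i) (strictlyInverseˡ j) (trans (sym (G≡E _ _))
      (K-clique _ _ (∈-preimage⁻ i∈K') (∈-preimage⁻ j∈K') (i≢j ∘ from-injective)))
  ~K' : ∀ {x} → AdjacentToAll G K x → AdjacentToAll E K' (to x)
  ~K' {x} x~K i i∈K' = subst (λ y → E (to x) y ≡ true) (strictlyInverseˡ i)
    (trans (sym (G≡E _ _)) (x~K _ (∈-preimage⁻ i∈K')))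

kTree-separates : ∀ {k} {G : Graph n} → IsKTree k G → KCliquesSeparate k G
kTree-separates (_ , built , σ , G≡E) = relabel-separates σ G≡E (built-separates built)

-- Neighbours of a (k+1)-clique

module Neighbour {k} {Δ Δ' : Subset n}
  (∣Δ∣≡1+k : ∣ Δ ∣ ≡ suc k) (∣Δ'∣≡1+k : ∣ Δ' ∣ ≡ suc k) (∣Δ∩Δ'∣≡k : ∣ Δ ∩ Δ' ∣ ≡ k) where

  private
    ∣Δ∣≡1+∣Δ∩Δ'∣ : ∣ Δ ∣ ≡ suc ∣ Δ ∩ Δ' ∣
    ∣Δ∣≡1+∣Δ∩Δ'∣ = trans ∣Δ∣≡1+k (cong suc (sym ∣Δ∩Δ'∣≡k))
    ∣Δ'∣≡1+∣Δ∩Δ'∣ : ∣ Δ' ∣ ≡ suc ∣ Δ ∩ Δ' ∣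
    ∣Δ'∣≡1+∣Δ∩Δ'∣ = trans ∣Δ'∣≡1+k (cong suc (sym ∣Δ∩Δ'∣≡k))

  dropped : ∃ λ u → u ∈ Δ × u ∉ Δ'
  dropped = let u , u∈Δ , u∉Δ∩Δ' = ∣p∣<∣q∣⇒∃∈q∉p (≤-reflexive (sym ∣Δ∣≡1+∣Δ∩Δ'∣))
            in  u , u∈Δ , λ u∈Δ' → u∉Δ∩Δ' (x∈p∩q⁺ (u∈Δ , u∈Δ'))

  added : ∃ λ v → v ∈ Δ' × v ∉ Δ
  added = let v , v∈Δ' , v∉Δ∩Δ' = ∣p∣<∣q∣⇒∃∈q∉p (≤-reflexive (sym ∣Δ'∣≡1+∣Δ∩Δ'∣))
          in  v , v∈Δ' , λ v∈Δ → v∉Δ∩Δ' (x∈p∩q⁺ (v∈Δ , v∈Δ'))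

  kept : ∀ {u i} → u ∈ Δ → u ∉ Δ' → i ∈ Δ → i ≢ u → i ∈ Δ'
  kept {u} {i} u∈Δ u∉Δ' i∈Δ i≢u = decidable-stable (i ∈? Δ') λ i∉Δ' →
    i≢u (∈q∉p-unique (p∩q⊆p Δ Δ') (≤-reflexive ∣Δ∣≡1+∣Δ∩Δ'∣) i∈Δ (i∉Δ' ∘ p∩q⊆q Δ Δ') u∈Δ (u∉Δ' ∘ p∩q⊆q Δ Δ'))

  added-unique : ∀ {v i} → v ∈ Δ' → v ∉ Δ → i ∈ Δ' → i ∉ Δ → i ≡ v
  added-unique v∈Δ' v∉Δ i∈Δ' i∉Δ =
    ∈q∉p-unique (p∩q⊆q Δ Δ') (≤-reflexive ∣Δ'∣≡1+∣Δ∩Δ'∣) i∈Δ' (i∉Δ ∘ p∩q⊆p Δ Δ') v∈Δ' (v∉Δ ∘ p∩q⊆p Δ Δ')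

  k≤∣Δ-u∣ : ∀ {u} → u ∉ Δ' → k ≤ ∣ Δ - u ∣
  k≤∣Δ-u∣ {u} u∉Δ' = ≤-trans (≤-reflexive (sym ∣Δ∩Δ'∣≡k)) (p⊆q⇒∣p∣≤∣q∣ Δ∩Δ'⊆Δ-u)
    where
    Δ∩Δ'⊆Δ-u : Δ ∩ Δ' ⊆ Δ - u
    Δ∩Δ'⊆Δ-u x∈Δ∩Δ' = let x∈Δ , x∈Δ' = x∈p∩q⁻ Δ Δ' x∈Δ∩Δ'
                      in  x∈p∧x≢y⇒x∈p-y x∈Δ λ { refl → u∉Δ' x∈Δ' }

module NeighbourBound {k d} {T G : Graph n}
  (T-undirected : Undirected T) (T-connected : Connected T) (T-degree : MaxDegreeAtMost T d)
  (T⊆G : SpanningSubgraph T G) (G-separates : KCliquesSeparate k G) (1≤k : 1 ≤ k)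
  {Δ : Subset n} (Δ-clique : IsClique G (suc k) Δ) where

  private
    module N {Δ'} (nb : IsNeighbor k G Δ Δ') =
      Neighbour {Δ = Δ} {Δ'} (proj₁ Δ-clique) (proj₁ (proj₁ nb)) (proj₂ nb)

  data Key (Δ' : Subset n) : Fin n × Fin n → Set where
    key : ∀ {u v w a} → u ∈ Δ → u ∉ Δ' → v ∈ Δ' → v ∉ Δ → a ∈ Δ → T a w ≡ true →
          WalkOutside T (Δ - u) v w → Key Δ' (u , w)

  find-key : ∀ {Δ'} → IsNeighbor k G Δ Δ' → ∃ (Key Δ')
  find-key nb with N.dropped nb | N.added nb
  ... | u , u∈Δ , u∉Δ' | v , v∈Δ' , v∉Δ with 1≤∣p∣⇒nonempty (≤-trans 1≤k (N.k≤∣Δ-u∣ nb u∉Δ'))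
  ... | t , t∈Δ-u with T-connected v t
  ... | x ∷ xs , refl , last≡t , _ , consecutive with exit-edge xs (v∉Δ ∘ p─q⊆p Δ _) t∈Δ-u consecutive last≡t
  ... | w , a , v⇝w , Twa , a∈Δ-u =
    (u , w) , key u∈Δ u∉Δ' v∈Δ' v∉Δ (p─q⊆p Δ _ a∈Δ-u) (trans (T-undirected a w) Twa) v⇝w

  Δ-u-clique : ∀ {u} → Clique G (Δ - u)
  Δ-u-clique i j i∈ j∈ = proj₂ Δ-clique i j (p─q⊆p Δ _ i∈) (p─q⊆p Δ _ j∈)

  added-adjacent : ∀ {Δ' u v} → IsNeighbor k G Δ Δ' →
    u ∈ Δ → u ∉ Δ' → v ∈ Δ' → v ∉ Δ → AdjacentToAll G (Δ - u) v
  added-adjacent nb u∈Δ u∉Δ' v∈Δ' v∉Δ i i∈Δ-u = proj₂ (proj₁ nb) _ i v∈Δ'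
    (N.kept nb u∈Δ u∉Δ' (p─q⊆p Δ _ i∈Δ-u) (x∈p-y⇒x≢y i∈Δ-u)) λ { refl → v∉Δ (p─q⊆p Δ _ i∈Δ-u) }

  same-dropped-added⇒⊆ : ∀ {Δ₁ Δ₂ u v} → IsNeighbor k G Δ Δ₁ → IsNeighbor k G Δ Δ₂ →
    u ∈ Δ → u ∉ Δ₁ → u ∉ Δ₂ → v ∈ Δ₁ → v ∉ Δ → v ∈ Δ₂ → Δ₁ ⊆ Δ₂
  same-dropped-added⇒⊆ {Δ₂ = Δ₂} nb₁ nb₂ u∈Δ u∉Δ₁ u∉Δ₂ v∈Δ₁ v∉Δ v∈Δ₂ {x} x∈Δ₁ with x ∈? Δ
  ... | yes x∈Δ = N.kept nb₂ u∈Δ u∉Δ₂ x∈Δ λ { refl → u∉Δ₁ x∈Δ₁ }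
  ... | no  x∉Δ = subst (_∈ Δ₂) (sym (N.added-unique nb₁ v∈Δ₁ v∉Δ x∈Δ₁ x∉Δ)) v∈Δ₂

  Key-injective : ∀ {Δ₁ Δ₂ κ} → IsNeighbor k G Δ Δ₁ → IsNeighbor k G Δ Δ₂ →
    Key Δ₁ κ → Key Δ₂ κ → Δ₁ ≡ Δ₂
  Key-injective nb₁ nb₂ (key {u} u∈Δ u∉Δ₁ v₁∈Δ₁ v₁∉Δ _ _ v₁⇝w) (key _ u∉Δ₂ v₂∈Δ₂ v₂∉Δ _ _ v₂⇝w)
    with G-separates (Δ - u) (N.k≤∣Δ-u∣ nb₁ u∉Δ₁) Δ-u-clique (v₁∉Δ ∘ p─q⊆p Δ _) (v₂∉Δ ∘ p─q⊆p Δ _)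
           (added-adjacent nb₁ u∈Δ u∉Δ₁ v₁∈Δ₁ v₁∉Δ) (added-adjacent nb₂ u∈Δ u∉Δ₂ v₂∈Δ₂ v₂∉Δ)
           (WalkOutside-mono T⊆G (v₁⇝w ◅◅ WalkOutside-reverse T-undirected v₂⇝w))
  ... | refl = ⊆-antisym (same-dropped-added⇒⊆ nb₁ nb₂ u∈Δ u∉Δ₁ u∉Δ₂ v₁∈Δ₁ v₁∉Δ v₂∈Δ₂)
                         (same-dropped-added⇒⊆ nb₂ nb₁ u∈Δ u∉Δ₂ u∉Δ₁ v₂∈Δ₂ v₂∉Δ v₁∈Δ₁)

  T-neighbours : List (Fin n)
  T-neighbours = concatMap (elements ∘ neighbourhood T) (elements Δ)

  candidates : List (Fin n × Fin n)
  candidates = cartesianProduct (elements Δ) T-neighbours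

  Key⇒∈candidates : ∀ {Δ' κ} → Key Δ' κ → κ ∈ˡ candidates
  Key⇒∈candidates (key u∈Δ _ _ _ a∈Δ Taw _) = ∈-cartesianProduct⁺ (∈-elements⁺ u∈Δ)
    (∈-concatMap⁺ (elements ∘ neighbourhood T) (lose (∈-elements⁺ a∈Δ) (∈-elements⁺ (∈-tabulate⁺ Taw))))

  length-candidates : length candidates ≤ suc k * (suc k * d)
  length-candidates = begin
    length candidates                               ≡⟨ length-cartesianProduct (elements Δ) T-neighbours ⟩
    length (elements Δ) * length T-neighbours       ≤⟨ *-monoʳ-≤ (length (elements Δ))
                                                         (length-concatMap≤ _ degree≤d (elements Δ)) ⟩
    length (elements Δ) * (length (elements Δ) * d) ≡⟨ cong (λ m → m * (m * d)) ∣Δ∣≡1+k ⟩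
    suc k * (suc k * d)                             ∎
    where
    open ≤-Reasoning
    ∣Δ∣≡1+k : length (elements Δ) ≡ suc k
    ∣Δ∣≡1+k = trans (length-elements Δ) (proj₁ Δ-clique)
    degree≤d : ∀ a → length (elements (neighbourhood T a)) ≤ d
    degree≤d a = ≤-trans (≤-reflexive (length-elements (neighbourhood T a))) (T-degree a)

  neighbours-length≤ : ∀ {L} → Unique L → All (IsNeighbor k G Δ) L → length L ≤ suc k * (suc k * d)
  neighbours-length≤ {L} L-unique neighbours =
    ≤-trans (injection⇒length≤ L-unique (proj₁ ∘ key-of) key-of-injective (Key⇒∈candidates ∘ proj₂ ∘ key-of))
            length-candidates
    where
    key-of : ∀ {Δ'} → Δ' ∈ˡ L → ∃ (Key Δ')
    key-of = find-key ∘ All.lookup neighbours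
    key-of-injective : ∀ {Δ₁ Δ₂} (p : Δ₁ ∈ˡ L) (q : Δ₂ ∈ˡ L) → proj₁ (key-of p) ≡ proj₁ (key-of q) → Δ₁ ≡ Δ₂
    key-of-injective p q κp≡κq = Key-injective (All.lookup neighbours p) (All.lookup neighbours q)
      (proj₂ (key-of p)) (subst (Key _) (sym κp≡κq) (proj₂ (key-of q)))

mainTheorem2 : (k d : ℕ) → 1 ≤ k → 1 ≤ d →
    ∃[ c ] ((n : ℕ) (T G : Graph n) → IsTree T → MaxDegreeAtMost T d →
      IsKTree k G → SpanningSubgraph T G →
      (Δ : Subset n) → IsClique G (suc k) Δ →
      (L : List (Subset n)) → Unique L → All (IsNeighbor k G Δ) L →
      length L ≤ c)
mainTheorem2 k d 1≤k _ = suc k * (suc k * d) ,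
  λ n T G ((T-undirected , _) , T-connected , _) T-degree G-kTree T⊆G Δ Δ-clique L L-unique neighbours →
    NeighbourBound.neighbours-length≤ T-undirected T-connected T-degree T⊆G (kTree-separates G-kTree) 1≤k
      Δ-clique L-unique neighbours
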